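{- Let $\mathcal{B}$ be a good choice on $[m]$ and $X\subseteq[m]$. Then $c(\mathcal{B},X)=n_t(\mathcal{B},X)+t(\mathcal{B},X)+1$, where $t(\mathcal{B},X)$ is the number of strongly connected components of $\mathcal{D}_{\mathcal{B}}(X)$ and $n_t(\mathcal{B},X)$ is the number of unordered pairs of distinct strongly connected components with no directed edge (in either direction) between them. Consequently $c(\mathcal{B},X)\leq n(\mathcal{B},X)+|X|+1$, with equality if all strongly connected components of $\mathcal{D}_{\mathcal{B}}(X)$ are singletons.
   Context: For $|T|=3$ and $x\in T$, $e_x\in\{0,1\}^T$ has a 1 at $x$ and 0 elsewhere, $\bar e_x=\mathbf 1-e_x$. A choice on $[m]$ is a family $\mathcal{B}=(B_T)_{T\in\binom{[m]}{3}}$ with each $B_T\subseteq\{0,1\}^T$ containing exactly one vector from each pair $\{e_x,\bar e_x\}$, $x\in T$; it is good if no $B_T$ equals $\{e_x\}_{x\in T}$ or $\{\bar e_x\}_{x\in T}$. For $X\subseteq[m]$, $c(\mathcal{B},X)$ is the number of $u\in\{0,1\}^X$ with $u|_T\notin B_T$ for every 3-subset $T\subseteq X$. $\mathcal{D}_{\mathcal{B}}(X)$ is the directed multigraph on $X$ which, for each 3-subset $T\subseteq X$ and each ordered pair $(x,y)$ of distinct elements of $T$ such that both vectors $u\in\{0,1\}^T$ with $u_x=0,u_y=1$ lie in $B_T$, has one edge $x\to y$. $n(\mathcal{B},X)$ is the number of unordered pairs of distinct $x,y\in X$ with no directed edge between $x$ and $y$ in $\mathcal{D}_{\mathcal{B}}(X)$.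 -}

module Defs where

open import Data.Nat using (ℕ; zero; suc)
open import Data.Bool using (Bool; true; false; not; _∧_; _∨_)
open import Data.Fin using (Fin; _<_; _<?_; _≟_)
open import Data.Fin.Subset using (Subset) renaming (_∈_ to _∈ₛ_)
open import Data.Vec using (Vec; []; _∷_; lookup; tabulate; map)
open import Data.List using (List; []; _∷_; length; filterᵇ; allFin; foldr)
import Data.List as L
open import Data.List.Membership.Propositional renaming (_∈_ to _∈ₗ_)
open import Data.List.Relation.Unary.Unique.Propositional using (Unique)
open import Data.Product using (Σ; _×_; _,_; ∃; ∃-syntax)
open import Data.Sum using (_⊎_)
open import Relation.Binary.PropositionalEquality using (_≡_; _≢_)
open import Relation.Binary.Construct.Closure.ReflexiveTransitive using (Star)
open import Relation.Nullary using (¬_)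
open import Relation.Nullary.Decidable using (⌊_⌋)

Card : (A : Set) → (A → Set) → ℕ → Set
Card A P n = Σ (List A) λ l →
  Unique l × (∀ a → a ∈ₗ l → P a) × (∀ a → P a → a ∈ₗ l) × length l ≡ n

-- 3-subsets T of [m] are written as increasing triples a < b < c.
-- A vector u ∈ {0,1}^T is written as (u_a , u_b , u_c) : Vec Bool 3
-- (false = 0, true = 1); position i : Fin 3 is the i-th element of T.

triple : ∀ {m} → Fin m → Fin m → Fin m → Vec (Fin m) 3
triple a b c = a ∷ b ∷ c ∷ []

e : Fin 3 → Vec Bool 3
e i = tabulate (λ j → ⌊ i ≟ j ⌋)

ē : Fin 3 → Vec Bool 3
ē i = map not (e i)

-- A choice on [m]: for every 3-subset T = {a<b<c}, a set B_T ⊆ {0,1}^T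
-- (given by its characteristic function  mem a b c) consisting of exactly
-- one vector from each pair {e_x , ē_x}.  (Values of mem at
-- non-increasing triples are irrelevant and never used.)
record Choice (m : ℕ) : Set where
  field
    mem : Fin m → Fin m → Fin m → Vec Bool 3 → Bool
    one-of-each : ∀ a b c → a < b → b < c → ∀ (i : Fin 3) →
      (mem a b c (e i) ≡ true × mem a b c (ē i) ≡ false)
      ⊎ (mem a b c (e i) ≡ false × mem a b c (ē i) ≡ true)
    nothing-else : ∀ a b c → a < b → b < c → ∀ (v : Vec Bool 3) →
      mem a b c v ≡ true → ∃[ i ] (v ≡ e i ⊎ v ≡ ē i)

open Choice public

Good : ∀ {m} → Choice m → Set
Good {m} B = ∀ (a b c : Fin m) → a < b → b < c →
    ¬ (∀ v → (mem B a b c v ≡ true → ∃[ i ] v ≡ e i)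
             × (∃[ i ] v ≡ e i → mem B a b c v ≡ true))
  × ¬ (∀ v → (mem B a b c v ≡ true → ∃[ i ] v ≡ ē i)
             × (∃[ i ] v ≡ ē i → mem B a b c v ≡ true))

-- c(B,X).  An element u ∈ {0,1}^X is represented by its extension by 0
-- outside X, i.e. by u : Vec Bool m with u_i = false for i ∉ X.

allVecs : ∀ m → List (Vec Bool m)
allVecs zero = [] ∷ []
allVecs (suc m) = L.map (false ∷_) (allVecs m) L.++ L.map (true ∷_) (allVecs m)

allᶠ : ∀ {m} → (Fin m → Bool) → Bool
allᶠ {m} p = foldr (λ i r → p i ∧ r) true (allFin m)

supportedIn : ∀ {m} → Subset m → Vec Bool m → Bool
supportedIn X u = allᶠ λ i → not (lookup u i) ∨ lookup X i

avoids : ∀ {m} → Choice m → Subset m → Vec Bool m → Bool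
avoids B X u = allᶠ λ a → allᶠ λ b → allᶠ λ c →
  not (⌊ a <? b ⌋ ∧ ⌊ b <? c ⌋ ∧ lookup X a ∧ lookup X b ∧ lookup X c)
  ∨ not (mem B a b c (lookup u a ∷ lookup u b ∷ lookup u c ∷ []))

cnt : ∀ {m} → Choice m → Subset m → ℕ
cnt {m} B X = length (filterᵇ (λ u → supportedIn X u ∧ avoids B X u) (allVecs m))

Edge : ∀ {m} → Choice m → Subset m → Fin m → Fin m → Set
Edge {m} B X x y = Σ (Fin m) λ a → Σ (Fin m) λ b → Σ (Fin m) λ c →
  a < b × b < c × a ∈ₛ X × b ∈ₛ X × c ∈ₛ X ×
  Σ (Fin 3) λ i → Σ (Fin 3) λ j → i ≢ j ×
  lookup (triple a b c) i ≡ x × lookup (triple a b c) j ≡ y ×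
  (∀ (u : Vec Bool 3) → lookup u i ≡ false → lookup u j ≡ true →
     mem B a b c u ≡ true)

Reach : ∀ {m} → Choice m → Subset m → Fin m → Fin m → Set
Reach B X = Star (Edge B X)

StrConn : ∀ {m} → Choice m → Subset m → Fin m → Fin m → Set
StrConn B X x y = Reach B X x y × Reach B X y x

IsSCC : ∀ {m} → Choice m → Subset m → Subset m → Set
IsSCC {m} B X S = Σ (Fin m) λ x → x ∈ₛ X ×
  (∀ y → (y ∈ₛ S → y ∈ₛ X × StrConn B X x y)
       × (y ∈ₛ X × StrConn B X x y → y ∈ₛ S))

NoEdgeBetween : ∀ {m} → Choice m → Subset m → Subset m → Subset m → Set
NoEdgeBetween B X S S' = ∀ x y → x ∈ₛ S → y ∈ₛ S' →
  ¬ Edge B X x y × ¬ Edge B X y x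

NumSCC : ∀ {m} → Choice m → Subset m → ℕ → Set
NumSCC {m} B X t = Card (Subset m) (IsSCC B X) t

-- n_t(B,X) = number of unordered pairs of distinct SCCs with no edge
-- between them; stated as: the number of ORDERED such pairs is 2·n_t.
NumNonAdjSCCPairs : ∀ {m} → Choice m → Subset m → ℕ → Set
NumNonAdjSCCPairs {m} B X nt =
  Card (Subset m × Subset m)
    (λ { (S , S') → IsSCC B X S × IsSCC B X S' × S ≢ S' × NoEdgeBetween B X S S' })
    (nt Data.Nat.+ nt)
  where import Data.Nat

NumNonAdjPairs : ∀ {m} → Choice m → Subset m → ℕ → Set
NumNonAdjPairs {m} B X n =
  Card (Fin m × Fin m)
    (λ { (x , y) → x < y × x ∈ₛ X × y ∈ₛ X × ¬ Edge B X x y × ¬ Edge B X y x })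
    n

-- Within a triple T the positions x with e_x ∈ B_T receive an edge from every other position of T,
-- and goodness guarantees that both kinds of position occur; so any three vertices of D = D_B(X)
-- have an apex, a vertex joined to the other two by edges pointing the same way.  A vector
-- supported in X avoids all B_T iff its support is closed under predecessors in D, so c(B,X)
-- counts the predecessor-closed subsets of X.  By the apex property no three vertices of such a
-- set are pairwise incomparable, and two distinct strongly connected components are incomparable
-- exactly when no edge joins them.  Hence a closed set is empty, the down-set of one component,
-- or the down-set of an unordered pair of non-adjacent components, and c(B,X) = 1 + t + n_t.
-- Representatives of non-adjacent components are non-adjacent vertices and t ≤ |X|, which gives
-- the inequality, with equality when all components are singletons.

module Submission where

open import Defs
open import Data.Bool using (Bool; true; false; not; _∧_; _∨_)
import Data.Bool.Properties as Bool
open import Data.Empty using (⊥; ⊥-elim)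
open import Data.Fin using (Fin; zero; suc; _<_; _<?_; _≟_) renaming (_≤_ to _≤ᶠ_)
open import Data.Fin.Induction using (<-wellFounded)
import Data.Fin.Properties as Fin
open import Data.Fin.Subset using (Subset; ∣_∣; inside; outside; Side; _⊆_; _⊂_; _-_)
  renaming (_∈_ to _∈ₛ_; ⊥ to ∅; ⊤ to full)
open import Data.Fin.Subset.Induction using (⊂-wellFounded)
open import Data.Fin.Subset.Properties
  using (_∈?_; anySubset?; nonempty?; ∈⊤; ∉⊥; ⊆-antisym; Empty-unique; p─q⊆p; x∈p∧x≢y⇒x∈p-y; x∈p⇒p-x⊂p; x∈p⇒∣p-x∣<∣p∣)
open import Data.List using (List; []; _∷_; length; filter; filterᵇ; foldr; allFin; map; tabulate; _++_; cartesianProduct)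
open import Data.List.Membership.Propositional using () renaming (_∈_ to _∈ₗ_)
open import Data.List.Membership.Propositional.Properties
  using (∈-∃++; ∈-++⁻; ∈-++⁺ˡ; ∈-++⁺ʳ; ∈-map⁺; ∈-map⁻; ∈-filter⁺; ∈-filter⁻; ∈-allFin; ∈-cartesianProduct⁺)
open import Data.List.Properties using (length-++-sucʳ; length-map; length-++)
open import Data.List.Relation.Unary.All using ([]; _∷_) renaming (lookup to All-lookup; tabulate to All-tabulate)
open import Data.List.Relation.Unary.AllPairs using ([]; _∷_)
open import Data.List.Relation.Unary.Any using (here; there)
open import Data.List.Relation.Unary.Unique.Propositional using (Unique)
import Data.List.Relation.Unary.Unique.Propositional.Properties as Unique
open import Data.Maybe using (Maybe; nothing; just)
open import Data.Nat using (ℕ; zero; suc; _+_; _≤_; z≤n; s≤s)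
open import Data.Nat.Properties
  using (+-comm; ≤-trans; ≤-antisym; ≤-reflexive; <⇒≤; +-monoˡ-≤; +-mono-≤; module ≤-Reasoning)
open import Data.Product using (Σ; ∃; ∃₂; _×_; _,_; proj₁; proj₂)
import Data.Product as Product
open import Data.Sum using (_⊎_; inj₁; inj₂; [_,_])
import Data.Sum as Sum
open import Data.Vec using (Vec; []; _∷_; lookup)
import Data.Vec as Vec
open import Data.Vec.Properties using (lookup∘tabulate; lookup-map; ∷-injectiveʳ; []=⇒lookup; lookup⇒[]=)
open import Function using (_∘_; id)
open import Function.Bundles using (Equivalence)
open import Induction.WellFounded using (Acc; acc)
open import Level using (0ℓ)
open import Relation.Binary using (Rel; Decidable; tri<; tri≈; tri>)
open import Relation.Binary.Construct.Closure.ReflexiveTransitive using (Star; ε; _◅_; _◅◅_)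
import Relation.Binary.Construct.Closure.ReflexiveTransitive as Star
open import Relation.Binary.PropositionalEquality
  using (_≡_; _≢_; refl; sym; trans; cong; cong₂; subst; subst₂; module ≡-Reasoning)
open import Relation.Nullary using (¬_; Dec; yes; no; does; ¬?)
open import Relation.Nullary.Decidable
  using (⌊_⌋; dec-true; dec-false; isYes≗does; map′; _×-dec_; _⊎-dec_; _→-dec_; decidable-stable; T?)
open import Relation.Unary using (Pred)
import Relation.Unary as U

module _ {A : Set} where

  length-mono : ∀ {xs ys : List A} → Unique xs → (∀ {x} → x ∈ₗ xs → x ∈ₗ ys) →
                length xs ≤ length ys
  length-mono {[]} _ _ = z≤n
  length-mono {x ∷ xs} (x∉xs ∷ xs!) xs⊆ys with ∈-∃++ (xs⊆ys (here refl))
  ... | ys₁ , ys₂ , refl = begin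
      suc (length xs)           ≤⟨ s≤s (length-mono xs! xs⊆ys₁++ys₂) ⟩
      suc (length (ys₁ ++ ys₂)) ≡⟨ length-++-sucʳ ys₁ x ys₂ ⟨
      length (ys₁ ++ x ∷ ys₂)   ∎
    where
    open ≤-Reasoning
    xs⊆ys₁++ys₂ : ∀ {y} → y ∈ₗ xs → y ∈ₗ ys₁ ++ ys₂
    xs⊆ys₁++ys₂ y∈xs with ∈-++⁻ ys₁ (xs⊆ys (there y∈xs))
    ... | inj₁ y∈ys₁ = ∈-++⁺ˡ y∈ys₁
    ... | inj₂ (here refl) = ⊥-elim (All-lookup x∉xs y∈xs refl)
    ... | inj₂ (there y∈ys₂) = ∈-++⁺ʳ ys₁ y∈ys₂

  length-cong : ∀ {xs ys : List A} → Unique xs → Unique ys →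
                (∀ {x} → x ∈ₗ xs → x ∈ₗ ys) → (∀ {x} → x ∈ₗ ys → x ∈ₗ xs) →
                length xs ≡ length ys
  length-cong xs! ys! xs⊆ys ys⊆xs = ≤-antisym (length-mono xs! xs⊆ys) (length-mono ys! ys⊆xs)

  map⁺-injectiveOn : ∀ {B : Set} (f : A → B) {xs : List A} → Unique xs →
                     (∀ {x y} → x ∈ₗ xs → y ∈ₗ xs → f x ≡ f y → x ≡ y) → Unique (map f xs)
  map⁺-injectiveOn f {[]} [] _ = []
  map⁺-injectiveOn f {x ∷ xs} (x∉xs ∷ xs!) inj =
    All-tabulate fx∉ ∷ map⁺-injectiveOn f xs! (λ x∈ y∈ → inj (there x∈) (there y∈))
    where
    fx∉ : ∀ {y} → y ∈ₗ map f xs → f x ≢ y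
    fx∉ y∈ fx≡y with ∈-map⁻ f y∈
    ... | z , z∈xs , refl = All-lookup x∉xs z∈xs (inj (here refl) (there z∈xs) fx≡y)

module _ {n : ℕ} {P : Pred (Fin n) 0ℓ} (P? : U.Decidable P) where

  toSubset : Subset n
  toSubset = Vec.tabulate (does ∘ P?)

  ∈-toSubset⁺ : ∀ {x} → P x → x ∈ₛ toSubset
  ∈-toSubset⁺ {x} px = lookup⇒[]= x toSubset (trans (lookup∘tabulate _ x) (dec-true (P? x) px))

  ∈-toSubset⁻ : ∀ {x} → x ∈ₛ toSubset → P x
  ∈-toSubset⁻ {x} x∈ = from-does (P? x) (trans (sym (lookup∘tabulate _ x)) ([]=⇒lookup x∈))
    where
    from-does : ∀ {Q : Set} (Q? : Dec Q) → does Q? ≡ true → Q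
    from-does (yes q) _ = q

length-filter-∈?-tabulate-suc : ∀ {j n} {s : Side} (p : Subset n) (f : Fin j → Fin n) →
  length (filter (_∈? (s Vec.∷ p)) (tabulate (suc ∘ f))) ≡ length (filter (_∈? p) (tabulate f))
length-filter-∈?-tabulate-suc {zero} p f = refl
length-filter-∈?-tabulate-suc {suc j} p f with does (f zero ∈? p)
... | true = cong suc (length-filter-∈?-tabulate-suc p (f ∘ suc))
... | false = length-filter-∈?-tabulate-suc p (f ∘ suc)

length-filter-∈?-allFin : ∀ {n} (p : Subset n) → length (filter (_∈? p) (allFin n)) ≡ ∣ p ∣
length-filter-∈?-allFin Vec.[] = refl
length-filter-∈?-allFin (inside Vec.∷ p) =
  cong suc (trans (length-filter-∈?-tabulate-suc p id) (length-filter-∈?-allFin p))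
length-filter-∈?-allFin (outside Vec.∷ p) =
  trans (length-filter-∈?-tabulate-suc p id) (length-filter-∈?-allFin p)

allSubset? : ∀ {n} {P : Pred (Subset n) 0ℓ} → U.Decidable P → Dec (∀ p → P p)
allSubset? P? with anySubset? (¬? ∘ P?)
... | yes (p , ¬Pp) = no λ ∀P → ¬Pp (∀P p)
... | no ∄¬P = yes λ p → decidable-stable (P? p) λ ¬Pp → ∄¬P (p , ¬Pp)

least-witness : ∀ {n} {P : Pred (Fin n) 0ℓ} → U.Decidable P →
                ∀ {x} → P x → ∃ λ r → P r × (∀ y → y < r → ¬ P y)
least-witness {P = P} P? = go (<-wellFounded _)
  where
  go : ∀ {x} → Acc _<_ x → P x → ∃ λ r → P r × (∀ y → y < r → ¬ P y)
  go {x} (acc rs) Px with Fin.any? (λ y → (y <? x) ×-dec P? y)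
  ... | yes (y , y<x , Py) = go (rs y<x) Py
  ... | no ∄y = x , Px , λ y y<x Py → ∄y (y , y<x , Py)

sorted-pair-unique : ∀ {n} {r s r' s' : Fin n} → r ≤ᶠ s → r' ≤ᶠ s' →
  (∀ {a} → a ≡ r ⊎ a ≡ s → a ≡ r' ⊎ a ≡ s') → (∀ {a} → a ≡ r' ⊎ a ≡ s' → a ≡ r ⊎ a ≡ s) →
  (r , s) ≡ (r' , s')
sorted-pair-unique r≤s r'≤s' ⊆' ⊇' = cong₂ _,_
  (Fin.≤-antisym (least r≤s (⊇' (inj₁ refl))) (least r'≤s' (⊆' (inj₁ refl))))
  (Fin.≤-antisym (greatest r'≤s' (⊆' (inj₂ refl))) (greatest r≤s (⊇' (inj₂ refl))))
  where
  least : ∀ {n} {a r s : Fin n} → r ≤ᶠ s → a ≡ r ⊎ a ≡ s → r ≤ᶠ a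
  least _ (inj₁ refl) = Fin.≤-refl
  least r≤s (inj₂ refl) = r≤s
  greatest : ∀ {n} {a r s : Fin n} → r ≤ᶠ s → a ≡ r ⊎ a ≡ s → a ≤ᶠ s
  greatest r≤s (inj₁ refl) = r≤s
  greatest _ (inj₂ refl) = Fin.≤-refl

module _ {A : Set} (E : Rel A 0ℓ) where

  Apex : A → A → A → Set
  Apex v p q = (E v p × E v q) ⊎ (E p v × E q v)

  HasApex : A → A → A → Set
  HasApex x y z = Apex x y z ⊎ Apex y x z ⊎ Apex z x y

  Apex-swap : ∀ {v p q} → Apex v p q → Apex v q p
  Apex-swap = Sum.map Product.swap Product.swap

  HasApex-swap₁₂ : ∀ {x y z} → HasApex x y z → HasApex y x z
  HasApex-swap₁₂ (inj₁ a) = inj₂ (inj₁ a)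
  HasApex-swap₁₂ (inj₂ (inj₁ a)) = inj₁ a
  HasApex-swap₁₂ (inj₂ (inj₂ a)) = inj₂ (inj₂ (Apex-swap a))

  HasApex-swap₂₃ : ∀ {x y z} → HasApex x y z → HasApex x z y
  HasApex-swap₂₃ (inj₁ a) = inj₁ (Apex-swap a)
  HasApex-swap₂₃ (inj₂ (inj₁ a)) = inj₂ (inj₂ a)
  HasApex-swap₂₃ (inj₂ (inj₂ a)) = inj₂ (inj₁ a)

  HasApex⇒edge : ∀ {x y z} → HasApex x y z → E x z ⊎ E z x ⊎ E y x ⊎ E z y
  HasApex⇒edge (inj₁ (inj₁ (_ , xz))) = inj₁ xz
  HasApex⇒edge (inj₁ (inj₂ (yx , _))) = inj₂ (inj₂ (inj₁ yx))
  HasApex⇒edge (inj₂ (inj₁ (inj₁ (yx , _)))) = inj₂ (inj₂ (inj₁ yx))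
  HasApex⇒edge (inj₂ (inj₁ (inj₂ (_ , zy)))) = inj₂ (inj₂ (inj₂ zy))
  HasApex⇒edge (inj₂ (inj₂ (inj₁ (zx , _)))) = inj₂ (inj₁ zx)
  HasApex⇒edge (inj₂ (inj₂ (inj₂ (xz , _)))) = inj₁ xz

HasApex-map : ∀ {A B : Set} {R : Rel A 0ℓ} {S : Rel B 0ℓ} (f : A → B) →
              (∀ {x y} → R x y → S (f x) (f y)) →
              ∀ {x y z} → HasApex R x y z → HasApex S (f x) (f y) (f z)
HasApex-map {R = R} {S} f hom = Sum.map apex (Sum.map apex apex)
  where
  apex : ∀ {v p q} → Apex R v p q → Apex S (f v) (f p) (f q)
  apex = Sum.map (Product.map hom hom) (Product.map hom hom)

module _ {n : ℕ} (R : Fin n → Fin n → Fin n → Set)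
         (swap₁₂ : ∀ {x y z} → R x y z → R y x z) (swap₂₃ : ∀ {x y z} → R x y z → R x z y)
         where

  sorted⇒distinct : (∀ {x y z} → x < y → y < z → R x y z) →
                    ∀ {x y z} → x ≢ y → y ≢ z → x ≢ z → R x y z
  sorted⇒distinct R< {x} {y} {z} x≢y y≢z x≢z with Fin.<-cmp x y | Fin.<-cmp y z | Fin.<-cmp x z
  ... | tri≈ _ x≡y _ | _ | _ = ⊥-elim (x≢y x≡y)
  ... | _ | tri≈ _ y≡z _ | _ = ⊥-elim (y≢z y≡z)
  ... | _ | _ | tri≈ _ x≡z _ = ⊥-elim (x≢z x≡z)
  ... | tri< x<y _ _ | tri< y<z _ _ | _ = R< x<y y<z
  ... | tri< _ _ _ | tri> _ _ z<y | tri< x<z _ _ = swap₂₃ (R< x<z z<y)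
  ... | tri< x<y _ _ | tri> _ _ _ | tri> _ _ z<x = swap₂₃ (swap₁₂ (R< z<x x<y))
  ... | tri> _ _ y<x | tri< _ _ _ | tri< x<z _ _ = swap₁₂ (R< y<x x<z)
  ... | tri> _ _ _ | tri< y<z _ _ | tri> _ _ z<x = swap₁₂ (swap₂₃ (R< y<z z<x))
  ... | tri> _ _ y<x | tri> _ _ z<y | _ = swap₁₂ (swap₂₃ (swap₁₂ (R< z<y y<x)))

-- Reachability in a finite digraph

module Reachability {m : ℕ} (E : Rel (Fin m) 0ℓ) (E? : Decidable E) where

  infix 4 _⇝_ _⇝?_

  _⇝_ : Rel (Fin m) 0ℓ
  _⇝_ = Star E

  WalkWithin : Subset m → Rel (Fin m) 0ℓ
  WalkWithin A = Star (λ x y → E x y × y ∈ₛ A)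

  WalkWithin-mono : ∀ {A A'} → A ⊆ A' → ∀ {x y} → WalkWithin A x y → WalkWithin A' x y
  WalkWithin-mono A⊆A' = Star.map (Product.map₂ A⊆A')

  -- the walk avoids z, or its part after the last visit of z does
  shortcut : ∀ {A x y} z → WalkWithin A x y → WalkWithin (A - z) x y ⊎ WalkWithin (A - z) z y
  shortcut z ε = inj₁ ε
  shortcut z (_◅_ {j = w} (e , w∈A) walk) with shortcut z walk
  ... | inj₂ tail = inj₂ tail
  ... | inj₁ walk' with w ≟ z
  ...   | yes refl = inj₂ walk'
  ...   | no w≢z = inj₁ ((e , x∈p∧x≢y⇒x∈p-y w∈A w≢z) ◅ walk')

  walkWithin? : ∀ {A} → Acc _⊂_ A → Decidable (WalkWithin A)
  walkWithin? {A} (acc rs) x y with x ≟ y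
  ... | yes refl = yes ε
  ... | no x≢y = map′ join split (Fin.any? firstStep?)
    where
    FirstStep : Fin m → Set
    FirstStep z = z ∈ₛ A × E x z × WalkWithin (A - z) z y

    firstStep? : ∀ z → Dec (FirstStep z)
    firstStep? z with z ∈? A
    ... | no z∉A = no (z∉A ∘ proj₁)
    ... | yes z∈A = map′ (z∈A ,_) proj₂ (E? x z ×-dec walkWithin? (rs (x∈p⇒p-x⊂p z∈A)) z y)

    join : ∃ FirstStep → WalkWithin A x y
    join (z , z∈A , e , walk) = (e , z∈A) ◅ WalkWithin-mono (p─q⊆p A _) walk

    split : WalkWithin A x y → ∃ FirstStep
    split ε = ⊥-elim (x≢y refl)
    split ((e , z∈A) ◅ walk) = _ , z∈A , e , [ id , id ] (shortcut _ walk)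

  _⇝?_ : Decidable _⇝_
  x ⇝? y = map′ (Star.map proj₁) (Star.map (_, ∈⊤)) (walkWithin? (⊂-wellFounded full) x y)

-- Digraphs in which any three vertices have an apex

module ApexDigraph {m : ℕ} (X : Subset m) (E : Rel (Fin m) 0ℓ) (E? : Decidable E)
  (edge⊆X : ∀ {x y} → E x y → x ∈ₛ X × y ∈ₛ X)
  (apex : ∀ {x y z} → x ∈ₛ X → y ∈ₛ X → z ∈ₛ X → x ≢ y → y ≢ z → x ≢ z → HasApex E x y z)
  where

  open Reachability E E? public

  infix 4 _⇄_ _⇄?_

  _⇄_ : Rel (Fin m) 0ℓ
  x ⇄ y = x ⇝ y × y ⇝ x

  _⇄?_ : Decidable _⇄_
  x ⇄? y = x ⇝? y ×-dec y ⇝? x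

  ⇄-refl : ∀ {x} → x ⇄ x
  ⇄-refl = ε , ε

  ⇄-sym : ∀ {x y} → x ⇄ y → y ⇄ x
  ⇄-sym = Product.swap

  ⇄-trans : ∀ {x y z} → x ⇄ y → y ⇄ z → x ⇄ z
  ⇄-trans (xy , yx) (yz , zy) = xy ◅◅ yz , zy ◅◅ yx

  reach-source∈X : ∀ {x y} → y ∈ₛ X → x ⇝ y → x ∈ₛ X
  reach-source∈X y∈X ε = y∈X
  reach-source∈X _ (e ◅ _) = proj₁ (edge⊆X e)

  reach-target∈X : ∀ {x y} → x ∈ₛ X → x ⇝ y → y ∈ₛ X
  reach-target∈X x∈X ε = x∈X
  reach-target∈X _ (e ◅ r) = reach-target∈X (proj₂ (edge⊆X e)) r

  Incomparable : Rel (Fin m) 0ℓ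
  Incomparable x y = ¬ x ⇝ y × ¬ y ⇝ x

  no-incomparable-triple : ∀ {x y z} → x ∈ₛ X → y ∈ₛ X → z ∈ₛ X →
    Incomparable x y → Incomparable y z → Incomparable x z → ⊥
  no-incomparable-triple x∈X y∈X z∈X (x↛y , y↛x) (y↛z , z↛y) (x↛z , z↛x)
    with HasApex⇒edge E (apex x∈X y∈X z∈X (λ { refl → x↛y ε }) (λ { refl → y↛z ε }) (λ { refl → x↛z ε }))
  ... | inj₁ xz = x↛z (xz ◅ ε)
  ... | inj₂ (inj₁ zx) = z↛x (zx ◅ ε)
  ... | inj₂ (inj₂ (inj₁ yx)) = y↛x (yx ◅ ε)
  ... | inj₂ (inj₂ (inj₂ zy)) = z↛y (zy ◅ ε)

  -- Follow a path from a to c: as long as the next vertex still reaches a we stay in the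
  -- component of a; at the first vertex w that does not, either c reaches w, or the apex
  -- of {a, w, c} gives an edge a → c.
  reach⇒edge-between-components : ∀ {a c} → a ∈ₛ X → a ⇝ c → ¬ c ⇝ a →
    ∃₂ λ p q → a ⇄ p × c ⇄ q × E p q
  reach⇒edge-between-components {a} {c} a∈X a→c c↛a = walk ⇄-refl a→c
    where
    walk : ∀ {p} → a ⇄ p → p ⇝ c → ∃₂ λ p q → a ⇄ p × c ⇄ q × E p q
    walk (_ , p→a) ε = ⊥-elim (c↛a p→a)
    walk {p} a⇄p (_◅_ {j = w} e w→c) with w ⇝? a
    ... | yes w→a = walk (proj₁ a⇄p ◅◅ e ◅ ε , w→a) w→c
    ... | no w↛a with c ⇝? w
    ...   | yes c→w = p , w , a⇄p , (c→w , w→c) , e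
    ...   | no c↛w with HasApex⇒edge E (apex a∈X (proj₂ (edge⊆X e)) (reach-target∈X a∈X a→c)
                          (λ { refl → w↛a ε }) (λ { refl → c↛w ε }) (λ { refl → c↛a ε }))
    ...     | inj₁ ac = a , c , ⇄-refl , ⇄-refl , ac
    ...     | inj₂ (inj₁ ca) = ⊥-elim (c↛a (ca ◅ ε))
    ...     | inj₂ (inj₂ (inj₁ wa)) = ⊥-elim (w↛a (wa ◅ ε))
    ...     | inj₂ (inj₂ (inj₂ cw)) = ⊥-elim (c↛w (cw ◅ ε))

  IsRep : Pred (Fin m) 0ℓ
  IsRep r = r ∈ₛ X × (∀ y → y < r → ¬ r ⇄ y)

  IsRep? : U.Decidable IsRep
  IsRep? r = (r ∈? X) ×-dec Fin.all? (λ y → (y <? r) →-dec ¬? (r ⇄? y))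

  rep : ∀ {x} → x ∈ₛ X → ∃ λ r → IsRep r × x ⇄ r
  rep x∈X with least-witness (_ ⇄?_) ⇄-refl
  ... | r , x⇄r , least =
    r , (reach-target∈X x∈X (proj₁ x⇄r) , λ y y<r r⇄y → least y y<r (⇄-trans x⇄r r⇄y)) , x⇄r

  rep-unique : ∀ {r s} → IsRep r → IsRep s → r ⇄ s → r ≡ s
  rep-unique {r} {s} (_ , r-least) (_ , s-least) r⇄s with Fin.<-cmp r s
  ... | tri< r<s _ _ = ⊥-elim (s-least r r<s (⇄-sym r⇄s))
  ... | tri≈ _ r≡s _ = r≡s
  ... | tri> _ _ s<r = ⊥-elim (r-least s s<r r⇄s)

  reps : List (Fin m)
  reps = filter IsRep? (allFin m)

  reps-unique : Unique reps
  reps-unique = Unique.filter⁺ IsRep? (Unique.allFin⁺ m)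

  ∈-reps⁺ : ∀ {r} → IsRep r → r ∈ₗ reps
  ∈-reps⁺ {r} = ∈-filter⁺ IsRep? (∈-allFin r)

  ∈-reps⁻ : ∀ {r} → r ∈ₗ reps → IsRep r
  ∈-reps⁻ = proj₂ ∘ ∈-filter⁻ IsRep? {xs = allFin m}

  component : Fin m → Subset m
  component r = toSubset (λ y → (y ∈? X) ×-dec (r ⇄? y))

  ∈-component⁺ : ∀ {r y} → y ∈ₛ X × r ⇄ y → y ∈ₛ component r
  ∈-component⁺ {r} = ∈-toSubset⁺ (λ y → (y ∈? X) ×-dec (r ⇄? y))

  ∈-component⁻ : ∀ {r y} → y ∈ₛ component r → y ∈ₛ X × r ⇄ y
  ∈-component⁻ {r} = ∈-toSubset⁻ (λ y → (y ∈? X) ×-dec (r ⇄? y))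

  IsComponent : Pred (Subset m) 0ℓ
  IsComponent S = Σ (Fin m) λ x → x ∈ₛ X ×
    (∀ y → (y ∈ₛ S → y ∈ₛ X × x ⇄ y) × (y ∈ₛ X × x ⇄ y → y ∈ₛ S))

  component-IsComponent : ∀ {r} → r ∈ₛ X → IsComponent (component r)
  component-IsComponent r∈X = _ , r∈X , λ y → ∈-component⁻ , ∈-component⁺

  component-⊆ : ∀ {r s} → s ⇄ r → component r ⊆ component s
  component-⊆ s⇄r y∈ = ∈-component⁺ (Product.map₂ (⇄-trans s⇄r) (∈-component⁻ y∈))

  component-cong : ∀ {r s} → r ⇄ s → component r ≡ component s
  component-cong r⇄s = ⊆-antisym (component-⊆ (⇄-sym r⇄s)) (component-⊆ r⇄s)

  component-injective : ∀ {r s} → IsRep r → IsRep s → component r ≡ component s → r ≡ s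
  component-injective {r} {s} r-rep s-rep eq =
    rep-unique r-rep s-rep
      (proj₂ (∈-component⁻ (subst (s ∈ₛ_) (sym eq) (∈-component⁺ (proj₁ s-rep , ⇄-refl)))))

  IsComponent⇒component : ∀ {S} → IsComponent S → ∃ λ r → IsRep r × S ≡ component r
  IsComponent⇒component {S} (x , x∈X , S≈) with rep x∈X
  ... | r , r-rep , x⇄r = r , r-rep , trans S≡component-x (component-cong x⇄r)
    where
    S≡component-x : S ≡ component x
    S≡component-x = ⊆-antisym (∈-component⁺ ∘ proj₁ (S≈ _)) (proj₂ (S≈ _) ∘ ∈-component⁻)

  numSCC : Card (Subset m) IsComponent (length reps)
  numSCC = map component reps
         , map⁺-injectiveOn component reps-unique
             (λ r∈ s∈ → component-injective (∈-reps⁻ r∈) (∈-reps⁻ s∈))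
         , (λ S S∈ → let r , r∈ , S≡ = ∈-map⁻ component S∈ in
                     subst IsComponent (sym S≡) (component-IsComponent (proj₁ (∈-reps⁻ r∈))))
         , (λ S S-scc → let r , r-rep , S≡ = IsComponent⇒component S-scc in
                        subst (_∈ₗ map component reps) (sym S≡) (∈-map⁺ component (∈-reps⁺ r-rep)))
         , length-map component reps

  NonAdjacent : Rel (Fin m) 0ℓ
  NonAdjacent r s = ∀ p q → r ⇄ p → s ⇄ q → ¬ E p q × ¬ E q p

  NonAdjacent? : Decidable NonAdjacent
  NonAdjacent? r s = Fin.all? λ p → Fin.all? λ q →
    (r ⇄? p) →-dec ((s ⇄? q) →-dec (¬? (E? p q) ×-dec ¬? (E? q p)))

  NonAdjacent-sym : ∀ {r s} → NonAdjacent r s → NonAdjacent s r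
  NonAdjacent-sym na p q s⇄p r⇄q = Product.swap (na q p r⇄q s⇄p)

  incomparable⇒nonAdjacent : ∀ {r s} → Incomparable r s → NonAdjacent r s
  incomparable⇒nonAdjacent (r↛s , s↛r) p q (r→p , p→r) (s→q , q→s) =
    (λ pq → r↛s (r→p ◅◅ pq ◅ q→s)) , (λ qp → s↛r (s→q ◅◅ qp ◅ p→r))

  nonAdjacent⇒unreachable : ∀ {r s} → IsRep r → IsRep s → r ≢ s → NonAdjacent r s → ¬ r ⇝ s
  nonAdjacent⇒unreachable {r} {s} r-rep s-rep r≢s na r→s with s ⇝? r
  ... | yes s→r = r≢s (rep-unique r-rep s-rep (r→s , s→r))
  ... | no s↛r with reach⇒edge-between-components (proj₁ r-rep) r→s s↛r
  ...   | p , q , r⇄p , s⇄q , pq = proj₁ (na p q r⇄p s⇄q) pq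

  nonAdjacent⇒incomparable : ∀ {r s} → IsRep r → IsRep s → r ≢ s → NonAdjacent r s → Incomparable r s
  nonAdjacent⇒incomparable r-rep s-rep r≢s na =
    nonAdjacent⇒unreachable r-rep s-rep r≢s na ,
    nonAdjacent⇒unreachable s-rep r-rep (r≢s ∘ sym) (NonAdjacent-sym na)

  -- each unordered pair is listed once, as (r , s) with r < s
  NonAdjacentReps : Fin m × Fin m → Set
  NonAdjacentReps (r , s) = IsRep r × IsRep s × r < s × NonAdjacent r s

  NonAdjacentReps? : U.Decidable NonAdjacentReps
  NonAdjacentReps? (r , s) = IsRep? r ×-dec (IsRep? s ×-dec ((r <? s) ×-dec NonAdjacent? r s))

  allPairs : List (Fin m × Fin m)
  allPairs = cartesianProduct (allFin m) (allFin m)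

  allPairs-unique : Unique allPairs
  allPairs-unique = Unique.cartesianProduct⁺ (Unique.allFin⁺ m) (Unique.allFin⁺ m)

  ∈-allPairs : ∀ r s → (r , s) ∈ₗ allPairs
  ∈-allPairs r s = ∈-cartesianProduct⁺ (∈-allFin r) (∈-allFin s)

  nonAdjacentReps : List (Fin m × Fin m)
  nonAdjacentReps = filter NonAdjacentReps? allPairs

  nonAdjacentReps-unique : Unique nonAdjacentReps
  nonAdjacentReps-unique = Unique.filter⁺ NonAdjacentReps? allPairs-unique

  ∈-nonAdjacentReps⁺ : ∀ {r s} → NonAdjacentReps (r , s) → (r , s) ∈ₗ nonAdjacentReps
  ∈-nonAdjacentReps⁺ {r} {s} = ∈-filter⁺ NonAdjacentReps? (∈-allPairs r s)

  ∈-nonAdjacentReps⁻ : ∀ {rs} → rs ∈ₗ nonAdjacentReps → NonAdjacentReps rs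
  ∈-nonAdjacentReps⁻ = proj₂ ∘ ∈-filter⁻ NonAdjacentReps? {xs = allPairs}

  Unlinked : Subset m → Subset m → Set
  Unlinked S S' = ∀ x y → x ∈ₛ S → y ∈ₛ S' → ¬ E x y × ¬ E y x

  NonAdjacentSCCs : Subset m × Subset m → Set
  NonAdjacentSCCs (S , S') = IsComponent S × IsComponent S' × S ≢ S' × Unlinked S S'

  unlinked⇒nonAdjacent : ∀ {r s} → r ∈ₛ X → s ∈ₛ X →
    Unlinked (component r) (component s) → NonAdjacent r s
  unlinked⇒nonAdjacent r∈X s∈X no-edge p q r⇄p s⇄q =
    no-edge p q (∈-component⁺ (reach-target∈X r∈X (proj₁ r⇄p) , r⇄p))
                (∈-component⁺ (reach-target∈X s∈X (proj₁ s⇄q) , s⇄q))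

  bothOrientations : List (Fin m × Fin m)
  bothOrientations = nonAdjacentReps ++ map Product.swap nonAdjacentReps

  ∈-bothOrientations⁻ : ∀ {r s} → (r , s) ∈ₗ bothOrientations →
                        IsRep r × IsRep s × r ≢ s × NonAdjacent r s
  ∈-bothOrientations⁻ rs∈ with ∈-++⁻ nonAdjacentReps rs∈
  ... | inj₁ rs∈ˡ = let r-rep , s-rep , r<s , na = ∈-nonAdjacentReps⁻ rs∈ˡ in
                   r-rep , s-rep , Fin.<⇒≢ r<s , na
  ... | inj₂ rs∈ʳ with ∈-map⁻ Product.swap rs∈ʳ
  ...   | _ , sr∈ , refl = let s-rep , r-rep , s<r , na = ∈-nonAdjacentReps⁻ sr∈ in
                          r-rep , s-rep , Fin.<⇒≢ s<r ∘ sym , NonAdjacent-sym na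

  bothOrientations-unique : Unique bothOrientations
  bothOrientations-unique = Unique.++⁺ nonAdjacentReps-unique
    (Unique.map⁺ (λ { {_ , _} {_ , _} refl → refl }) nonAdjacentReps-unique) disjoint
    where
    disjoint : ∀ {rs} → ¬ (rs ∈ₗ nonAdjacentReps × rs ∈ₗ map Product.swap nonAdjacentReps)
    disjoint (rs∈ , rs∈ʳ) with ∈-map⁻ Product.swap rs∈ʳ
    ... | _ , sr∈ , refl =
      let _ , _ , r<s , _ = ∈-nonAdjacentReps⁻ rs∈
          _ , _ , s<r , _ = ∈-nonAdjacentReps⁻ sr∈
      in Fin.<-asym r<s s<r

  componentPair : Fin m × Fin m → Subset m × Subset m
  componentPair (r , s) = component r , component s

  numNonAdjacentSCCs : Card (Subset m × Subset m) NonAdjacentSCCs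
                            (length nonAdjacentReps + length nonAdjacentReps)
  numNonAdjacentSCCs =
      map componentPair bothOrientations
    , map⁺-injectiveOn componentPair bothOrientations-unique injective
    , sound , complete
    , trans (length-map componentPair bothOrientations)
            (trans (length-++ nonAdjacentReps) (cong (length nonAdjacentReps +_) (length-map Product.swap nonAdjacentReps)))
    where
    injective : ∀ {rs rs'} → rs ∈ₗ bothOrientations → rs' ∈ₗ bothOrientations →
                componentPair rs ≡ componentPair rs' → rs ≡ rs'
    injective {_ , _} {_ , _} rs∈ rs'∈ eq =
      let r-rep , s-rep , _ = ∈-bothOrientations⁻ rs∈
          r'-rep , s'-rep , _ = ∈-bothOrientations⁻ rs'∈
      in cong₂ _,_ (component-injective r-rep r'-rep (cong proj₁ eq))
                   (component-injective s-rep s'-rep (cong proj₂ eq))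
    sound : ∀ SS → SS ∈ₗ map componentPair bothOrientations → NonAdjacentSCCs SS
    sound _ SS∈ with ∈-map⁻ componentPair SS∈
    ... | (r , s) , rs∈ , refl =
      let r-rep , s-rep , r≢s , na = ∈-bothOrientations⁻ rs∈ in
        component-IsComponent (proj₁ r-rep) , component-IsComponent (proj₁ s-rep)
      , r≢s ∘ component-injective r-rep s-rep
      , λ x y x∈ y∈ → na x y (proj₂ (∈-component⁻ x∈)) (proj₂ (∈-component⁻ y∈))
    complete : ∀ SS → NonAdjacentSCCs SS → SS ∈ₗ map componentPair bothOrientations
    complete (S , S') (S-scc , S'-scc , S≢S' , no-edge)
      with IsComponent⇒component S-scc | IsComponent⇒component S'-scc
    ... | r , r-rep , refl | s , s-rep , refl with Fin.<-cmp r s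
    ...   | tri< r<s _ _ = ∈-map⁺ componentPair (∈-++⁺ˡ (∈-nonAdjacentReps⁺ (r-rep , s-rep , r<s , na)))
      where na = unlinked⇒nonAdjacent (proj₁ r-rep) (proj₁ s-rep) no-edge
    ...   | tri≈ _ r≡s _ = ⊥-elim (S≢S' (cong component r≡s))
    ...   | tri> _ _ s<r = ∈-map⁺ componentPair (∈-++⁺ʳ nonAdjacentReps
              (∈-map⁺ Product.swap (∈-nonAdjacentReps⁺ (s-rep , r-rep , s<r , NonAdjacent-sym na))))
      where na = unlinked⇒nonAdjacent (proj₁ r-rep) (proj₁ s-rep) no-edge

  Closed : Pred (Subset m) 0ℓ
  Closed u = ∀ {x y} → E x y → y ∈ₛ u → x ∈ₛ u

  Closed-reach : ∀ {u} → Closed u → ∀ {x y} → x ⇝ y → y ∈ₛ u → x ∈ₛ u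
  Closed-reach u-closed ε y∈u = y∈u
  Closed-reach u-closed (e ◅ r) y∈u = u-closed e (Closed-reach u-closed r y∈u)

  ↓₂ : Fin m → Fin m → Subset m
  ↓₂ r s = toSubset (λ z → z ⇝? r ⊎-dec z ⇝? s)

  ∈-↓₂⁺ : ∀ {r s z} → z ⇝ r ⊎ z ⇝ s → z ∈ₛ ↓₂ r s
  ∈-↓₂⁺ {r} {s} = ∈-toSubset⁺ (λ z → z ⇝? r ⊎-dec z ⇝? s)

  ∈-↓₂⁻ : ∀ {r s z} → z ∈ₛ ↓₂ r s → z ⇝ r ⊎ z ⇝ s
  ∈-↓₂⁻ {r} {s} = ∈-toSubset⁻ (λ z → z ⇝? r ⊎-dec z ⇝? s)

  ↓₂-comm : ∀ r s → ↓₂ r s ≡ ↓₂ s r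
  ↓₂-comm r s = ⊆-antisym (∈-↓₂⁺ ∘ Sum.swap ∘ ∈-↓₂⁻) (∈-↓₂⁺ ∘ Sum.swap ∘ ∈-↓₂⁻)

  ↓₂-closed : ∀ {r s} → Closed (↓₂ r s)
  ↓₂-closed e z∈ = ∈-↓₂⁺ (Sum.map (e ◅_) (e ◅_) (∈-↓₂⁻ z∈))

  ↓₂⊆X : ∀ {r s} → r ∈ₛ X → s ∈ₛ X → ↓₂ r s ⊆ X
  ↓₂⊆X r∈X s∈X = [ reach-source∈X r∈X , reach-source∈X s∈X ] ∘ ∈-↓₂⁻

  Closed⇒≡↓₂ : ∀ {u a b} → Closed u → a ∈ₛ u → b ∈ₛ u →
    (∀ {z} → z ∈ₛ u → z ⇝ a ⊎ z ⇝ b) → u ≡ ↓₂ a b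
  Closed⇒≡↓₂ u-closed a∈u b∈u cover = ⊆-antisym (∈-↓₂⁺ ∘ cover)
    ([ (λ z→a → Closed-reach u-closed z→a a∈u) , (λ z→b → Closed-reach u-closed z→b b∈u) ] ∘ ∈-↓₂⁻)

  Maximal : Subset m → Fin m → Set
  Maximal u w = ∀ {w'} → w' ∈ₛ u → w ⇝ w' → w' ⇝ w

  maximal-above : ∀ {u w} → w ∈ₛ u → ∃ λ w' → w' ∈ₛ u × w ⇝ w' × Maximal u w'
  maximal-above {u} {w} = go (⊂-wellFounded (above w))
    where
    above : Fin m → Subset m
    above w = toSubset (λ z → (z ∈? u) ×-dec w ⇝? z)

    ∈-above⁺ : ∀ {w z} → z ∈ₛ u × w ⇝ z → z ∈ₛ above w
    ∈-above⁺ {w} = ∈-toSubset⁺ (λ z → (z ∈? u) ×-dec w ⇝? z)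

    ∈-above⁻ : ∀ {w z} → z ∈ₛ above w → z ∈ₛ u × w ⇝ z
    ∈-above⁻ {w} = ∈-toSubset⁻ (λ z → (z ∈? u) ×-dec w ⇝? z)

    go : ∀ {w} → Acc _⊂_ (above w) → w ∈ₛ u → ∃ λ w' → w' ∈ₛ u × w ⇝ w' × Maximal u w'
    go {w} (acc rs) w∈u with Fin.any? (λ w' → (w' ∈? u) ×-dec (w ⇝? w' ×-dec ¬? (w' ⇝? w)))
    ... | no ∄w' = w , w∈u , ε , λ w'∈u w→w' →
          decidable-stable (_ ⇝? w) λ w'↛w → ∄w' (_ , w'∈u , w→w' , w'↛w)
    ... | yes (w' , w'∈u , w→w' , w'↛w) =
      let w'' , w''∈u , w'→w'' , w''-max = go (rs above-w'⊂above-w) w'∈u in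
      w'' , w''∈u , w→w' ◅◅ w'→w'' , w''-max
      where
      above-w'⊂above-w : above w' ⊂ above w
      above-w'⊂above-w = (∈-above⁺ ∘ Product.map₂ (w→w' ◅◅_) ∘ ∈-above⁻)
                       , w , ∈-above⁺ (w∈u , ε) , λ w∈ → w'↛w (proj₂ (∈-above⁻ w∈))

  maximal-rep-above : ∀ {u w} → u ⊆ X → Closed u → w ∈ₛ u →
    ∃ λ r → IsRep r × r ∈ₛ u × w ⇝ r × Maximal u r
  maximal-rep-above u⊆X u-closed w∈u with maximal-above w∈u
  ... | w' , w'∈u , w→w' , w'-max with rep (u⊆X w'∈u)
  ...   | r , r-rep , (w'→r , r→w') =
    r , r-rep , Closed-reach u-closed r→w' w'∈u , w→w' ◅◅ w'→r ,
    λ z∈u r→z → w'-max z∈u (w'→r ◅◅ r→z) ◅◅ w'→r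

  two-maximal-cover : ∀ {u r₁ r₂} → u ⊆ X → r₁ ∈ₛ u → r₂ ∈ₛ u →
    Maximal u r₁ → Maximal u r₂ → Incomparable r₁ r₂ →
    ∀ {w} → w ∈ₛ u → w ⇝ r₁ ⊎ w ⇝ r₂
  two-maximal-cover {u} {r₁} {r₂} u⊆X r₁∈u r₂∈u r₁-max r₂-max r₁⋈r₂ w∈u with maximal-above w∈u
  ... | w' , w'∈u , w→w' , w'-max with w' ⇝? r₁ | w' ⇝? r₂
  ...   | yes w'→r₁ | _ = inj₁ (w→w' ◅◅ w'→r₁)
  ...   | no _ | yes w'→r₂ = inj₂ (w→w' ◅◅ w'→r₂)
  ...   | no w'↛r₁ | no w'↛r₂ = ⊥-elim (no-incomparable-triple (u⊆X r₁∈u) (u⊆X w'∈u) (u⊆X r₂∈u)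
          ((λ r₁→w' → w'↛r₁ (r₁-max w'∈u r₁→w')) , w'↛r₁) (w'↛r₂ , λ r₂→w' → w'↛r₂ (r₂-max w'∈u r₂→w'))
          r₁⋈r₂)

  -- (r , r) codes the down-set of one component, (r , s) with r < s that of two non-adjacent ones
  GoodPair : Fin m → Fin m → Set
  GoodPair r s = IsRep r × IsRep s × (r ≡ s ⊎ r < s × NonAdjacent r s)

  GoodPair-comparable⇒≡ : ∀ {r s} → GoodPair r s → r ⇝ s ⊎ s ⇝ r → r ≡ s
  GoodPair-comparable⇒≡ (_ , _ , inj₁ r≡s) _ = r≡s
  GoodPair-comparable⇒≡ (r-rep , s-rep , inj₂ (r<s , na)) r⇆s =
    ⊥-elim ([ proj₁ ⋈ , proj₂ ⋈ ] r⇆s)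
    where ⋈ = nonAdjacent⇒incomparable r-rep s-rep (Fin.<⇒≢ r<s) na

  GoodPair-≤ : ∀ {r s} → GoodPair r s → r ≤ᶠ s
  GoodPair-≤ (_ , _ , inj₁ refl) = Fin.≤-refl
  GoodPair-≤ (_ , _ , inj₂ (r<s , _)) = <⇒≤ r<s

  maximal-↓₂ : ∀ {r s} → (r ⇝ s → r ≡ s) → Maximal (↓₂ r s) r
  maximal-↓₂ r→s⇒r≡s z∈ r→z with ∈-↓₂⁻ z∈
  ... | inj₁ z→r = z→r
  ... | inj₂ z→s with r→s⇒r≡s (r→z ◅◅ z→s)
  ...   | refl = z→s

  endpoint⇒maximal : ∀ {r s a} → GoodPair r s → a ≡ r ⊎ a ≡ s →
    IsRep a × a ∈ₛ ↓₂ r s × Maximal (↓₂ r s) a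
  endpoint⇒maximal gp@(r-rep , _ , _) (inj₁ refl) =
    r-rep , ∈-↓₂⁺ (inj₁ ε) , maximal-↓₂ (GoodPair-comparable⇒≡ gp ∘ inj₁)
  endpoint⇒maximal {r} {s} gp@(_ , s-rep , _) (inj₂ refl) =
    s-rep , ∈-↓₂⁺ (inj₂ ε) ,
    subst (λ D → Maximal D s) (↓₂-comm s r) (maximal-↓₂ (sym ∘ GoodPair-comparable⇒≡ gp ∘ inj₂))

  maximal⇒endpoint : ∀ {r s a} → IsRep r → IsRep s → IsRep a → a ∈ₛ ↓₂ r s →
    Maximal (↓₂ r s) a → a ≡ r ⊎ a ≡ s
  maximal⇒endpoint r-rep s-rep a-rep a∈ a-max with ∈-↓₂⁻ a∈
  ... | inj₁ a→r = inj₁ (rep-unique a-rep r-rep (a→r , a-max (∈-↓₂⁺ (inj₁ ε)) a→r))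
  ... | inj₂ a→s = inj₂ (rep-unique a-rep s-rep (a→s , a-max (∈-↓₂⁺ (inj₂ ε)) a→s))

  codes : List (Maybe (Fin m × Fin m))
  codes = nothing ∷ map just (map (λ r → r , r) reps ++ nonAdjacentReps)

  length-codes : length codes ≡ suc (length reps + length nonAdjacentReps)
  length-codes = cong suc (trans (length-map just (map (λ r → r , r) reps ++ nonAdjacentReps))
    (trans (length-++ (map (λ r → r , r) reps) {nonAdjacentReps}) (cong (_+ length nonAdjacentReps) (length-map _ reps))))

  ∈-codes⁺ : ∀ {r s} → GoodPair r s → just (r , s) ∈ₗ codes
  ∈-codes⁺ (r-rep , _ , inj₁ refl) = there (∈-map⁺ just (∈-++⁺ˡ (∈-map⁺ (λ r → r , r) (∈-reps⁺ r-rep))))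
  ∈-codes⁺ (r-rep , s-rep , inj₂ (r<s , na)) =
    there (∈-map⁺ just (∈-++⁺ʳ (map (λ r → r , r) reps) (∈-nonAdjacentReps⁺ (r-rep , s-rep , r<s , na))))

  ∈-codes⁻ : ∀ {r s} → just (r , s) ∈ₗ codes → GoodPair r s
  ∈-codes⁻ (there rs∈) with ∈-map⁻ just rs∈
  ... | _ , rs∈' , refl with ∈-++⁻ (map (λ r → r , r) reps) rs∈'
  ...   | inj₂ rs∈ʳ = let r-rep , s-rep , r<s , na = ∈-nonAdjacentReps⁻ rs∈ʳ in
                     r-rep , s-rep , inj₂ (r<s , na)
  ...   | inj₁ rr∈ with ∈-map⁻ (λ r → r , r) rr∈
  ...     | _ , r∈ , refl = ∈-reps⁻ r∈ , ∈-reps⁻ r∈ , inj₁ refl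

  codes-unique : Unique codes
  codes-unique = All-tabulate nothing∉ ∷ Unique.map⁺ (λ { refl → refl })
    (Unique.++⁺ (Unique.map⁺ (λ { refl → refl }) reps-unique) nonAdjacentReps-unique disjoint)
    where
    nothing∉ : ∀ {c} → c ∈ₗ map just (map (λ r → r , r) reps ++ nonAdjacentReps) → nothing ≢ c
    nothing∉ c∈ with ∈-map⁻ just c∈
    ... | _ , _ , refl = λ ()
    disjoint : ∀ {rs} → ¬ (rs ∈ₗ map (λ r → r , r) reps × rs ∈ₗ nonAdjacentReps)
    disjoint (rr∈ , rs∈) with ∈-map⁻ (λ r → r , r) rr∈
    ... | _ , _ , refl = Fin.<-irrefl refl (proj₁ (proj₂ (proj₂ (∈-nonAdjacentReps⁻ rs∈))))

  generated : Maybe (Fin m × Fin m) → Subset m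
  generated nothing = ∅
  generated (just (r , s)) = ↓₂ r s

  generated-closed : ∀ c → Closed (generated c)
  generated-closed nothing _ y∈∅ = ⊥-elim (∉⊥ y∈∅)
  generated-closed (just _) = ↓₂-closed

  generated⊆X : ∀ {c} → c ∈ₗ codes → generated c ⊆ X
  generated⊆X {nothing} _ = ⊥-elim ∘ ∉⊥
  generated⊆X {just _} c∈ = let r-rep , s-rep , _ = ∈-codes⁻ c∈ in ↓₂⊆X (proj₁ r-rep) (proj₁ s-rep)

  generated-injective : ∀ {c c'} → c ∈ₗ codes → c' ∈ₗ codes → generated c ≡ generated c' → c ≡ c'
  generated-injective {nothing} {nothing} _ _ _ = refl
  generated-injective {nothing} {just _} _ _ ∅≡ = ⊥-elim (∉⊥ (subst (_ ∈ₛ_) (sym ∅≡) (∈-↓₂⁺ (inj₁ ε))))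
  generated-injective {just _} {nothing} _ _ ≡∅ = ⊥-elim (∉⊥ (subst (_ ∈ₛ_) ≡∅ (∈-↓₂⁺ (inj₁ ε))))
  generated-injective {just _} {just _} c∈ c'∈ eq = cong just
    (sorted-pair-unique (GoodPair-≤ gp) (GoodPair-≤ gp') (same-endpoints gp gp' eq) (same-endpoints gp' gp (sym eq)))
    where
    gp = ∈-codes⁻ c∈
    gp' = ∈-codes⁻ c'∈
    same-endpoints : ∀ {r s r' s'} → GoodPair r s → GoodPair r' s' → ↓₂ r s ≡ ↓₂ r' s' →
                ∀ {a} → a ≡ r ⊎ a ≡ s → a ≡ r' ⊎ a ≡ s'
    same-endpoints gp (r'-rep , s'-rep , _) eq a∈ with endpoint⇒maximal gp a∈
    ... | a-rep , a∈↓ , a-max rewrite eq = maximal⇒endpoint r'-rep s'-rep a-rep a∈↓ a-max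

  two-maximal⇒generated : ∀ {u r₁ r₂} → u ⊆ X → Closed u → IsRep r₁ → IsRep r₂ → r₁ ∈ₛ u → r₂ ∈ₛ u →
    Maximal u r₁ → Maximal u r₂ → Incomparable r₁ r₂ → ∃ λ c → c ∈ₗ codes × u ≡ generated c
  two-maximal⇒generated {r₁ = r₁} {r₂} u⊆X u-closed r₁-rep r₂-rep r₁∈u r₂∈u r₁-max r₂-max r₁⋈r₂
    with Fin.<-cmp r₁ r₂
  ... | tri< r₁<r₂ _ _ = just (r₁ , r₂) ,
        ∈-codes⁺ (r₁-rep , r₂-rep , inj₂ (r₁<r₂ , incomparable⇒nonAdjacent r₁⋈r₂)) ,
        Closed⇒≡↓₂ u-closed r₁∈u r₂∈u (two-maximal-cover u⊆X r₁∈u r₂∈u r₁-max r₂-max r₁⋈r₂)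
  ... | tri≈ _ refl _ = ⊥-elim (proj₁ r₁⋈r₂ ε)
  ... | tri> _ _ r₂<r₁ = just (r₂ , r₁) ,
        ∈-codes⁺ (r₂-rep , r₁-rep , inj₂ (r₂<r₁ , incomparable⇒nonAdjacent (Product.swap r₁⋈r₂))) ,
        Closed⇒≡↓₂ u-closed r₂∈u r₁∈u (Sum.swap ∘ two-maximal-cover u⊆X r₁∈u r₂∈u r₁-max r₂-max r₁⋈r₂)

  -- A nonempty closed set has one or two maximal components; three would be pairwise incomparable.
  Closed⇒generated : ∀ {u} → u ⊆ X → Closed u → ∃ λ c → c ∈ₗ codes × u ≡ generated c
  Closed⇒generated {u} u⊆X u-closed with nonempty? u
  ... | no u-empty = nothing , here refl , Empty-unique u-empty
  ... | yes (x , x∈u) with maximal-rep-above u⊆X u-closed x∈u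
  ...   | r₁ , r₁-rep , r₁∈u , _ , r₁-max with Fin.any? (λ z → (z ∈? u) ×-dec ¬? (z ⇝? r₁))
  ...     | no ∄z = just (r₁ , r₁) , ∈-codes⁺ (r₁-rep , r₁-rep , inj₁ refl) ,
            Closed⇒≡↓₂ u-closed r₁∈u r₁∈u
              λ z∈u → inj₁ (decidable-stable (_ ⇝? r₁) λ z↛r₁ → ∄z (_ , z∈u , z↛r₁))
  ...     | yes (z , z∈u , z↛r₁) with maximal-rep-above u⊆X u-closed z∈u
  ...       | r₂ , r₂-rep , r₂∈u , z→r₂ , r₂-max =
    two-maximal⇒generated u⊆X u-closed r₁-rep r₂-rep r₁∈u r₂∈u r₁-max r₂-max
      ((λ r₁→r₂ → r₂↛r₁ (r₁-max r₂∈u r₁→r₂)) , r₂↛r₁)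
    where
    r₂↛r₁ : ¬ r₂ ⇝ r₁
    r₂↛r₁ r₂→r₁ = z↛r₁ (z→r₂ ◅◅ r₂→r₁)

  length-closedSets : (closedSets : List (Subset m)) → Unique closedSets →
    (∀ {u} → u ∈ₗ closedSets → u ⊆ X × Closed u) → (∀ {u} → u ⊆ X → Closed u → u ∈ₗ closedSets) →
    length closedSets ≡ suc (length reps + length nonAdjacentReps)
  length-closedSets closedSets closedSets-unique sound complete = begin
    length closedSets            ≡⟨ length-cong closedSets-unique image-unique closedSets⊆image image⊆closedSets ⟩
    length (map generated codes) ≡⟨ length-map generated codes ⟩
    length codes                 ≡⟨ length-codes ⟩
    suc (length reps + length nonAdjacentReps) ∎
    where
    open ≡-Reasoning
    image-unique : Unique (map generated codes)
    image-unique = map⁺-injectiveOn generated codes-unique generated-injective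
    closedSets⊆image : ∀ {u} → u ∈ₗ closedSets → u ∈ₗ map generated codes
    closedSets⊆image u∈ with Closed⇒generated (proj₁ (sound u∈)) (proj₂ (sound u∈))
    ... | c , c∈ , refl = ∈-map⁺ generated c∈
    image⊆closedSets : ∀ {u} → u ∈ₗ map generated codes → u ∈ₗ closedSets
    image⊆closedSets u∈ with ∈-map⁻ generated u∈
    ... | c , c∈ , refl = complete (generated⊆X c∈) (generated-closed c)

  NonAdjacentVertices : Fin m × Fin m → Set
  NonAdjacentVertices (x , y) = x < y × x ∈ₛ X × y ∈ₛ X × ¬ E x y × ¬ E y x

  NonAdjacentVertices? : U.Decidable NonAdjacentVertices
  NonAdjacentVertices? (x , y) = (x <? y) ×-dec ((x ∈? X) ×-dec ((y ∈? X) ×-dec (¬? (E? x y) ×-dec ¬? (E? y x))))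

  nonAdjacentVertices : List (Fin m × Fin m)
  nonAdjacentVertices = filter NonAdjacentVertices? allPairs

  nonAdjacentVertices-unique : Unique nonAdjacentVertices
  nonAdjacentVertices-unique = Unique.filter⁺ NonAdjacentVertices? allPairs-unique

  ∈-nonAdjacentVertices⁺ : ∀ {x y} → NonAdjacentVertices (x , y) → (x , y) ∈ₗ nonAdjacentVertices
  ∈-nonAdjacentVertices⁺ {x} {y} = ∈-filter⁺ NonAdjacentVertices? (∈-allPairs x y)

  numNonAdjacentVertices : Card (Fin m × Fin m) NonAdjacentVertices (length nonAdjacentVertices)
  numNonAdjacentVertices = nonAdjacentVertices , nonAdjacentVertices-unique ,
    (λ _ → proj₂ ∘ ∈-filter⁻ NonAdjacentVertices? {xs = allPairs}) ,
    (λ _ → ∈-nonAdjacentVertices⁺) , refl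

  length-nonAdjacentReps≤ : length nonAdjacentReps ≤ length nonAdjacentVertices
  length-nonAdjacentReps≤ = length-mono nonAdjacentReps-unique λ {(r , s)} rs∈ →
    let r-rep , s-rep , r<s , na = ∈-nonAdjacentReps⁻ rs∈ in
    ∈-nonAdjacentVertices⁺ (r<s , proj₁ r-rep , proj₁ s-rep , na r s ⇄-refl ⇄-refl)

  length-reps≤∣X∣ : length reps ≤ ∣ X ∣
  length-reps≤∣X∣ = ≤-trans
    (length-mono reps-unique (λ {r} r∈ → ∈-filter⁺ (_∈? X) (∈-allFin r) (proj₁ (∈-reps⁻ r∈))))
    (≤-reflexive (length-filter-∈?-allFin X))

  module SingletonComponents (singletons : ∀ S → IsComponent S → ∣ S ∣ ≡ 1) where

    ⇄⇒≡ : ∀ {x y} → x ∈ₛ X → x ⇄ y → x ≡ y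
    ⇄⇒≡ {x} {y} x∈X x⇄y with x ≟ y
    ... | yes x≡y = x≡y
    ... | no x≢y = ⊥-elim (2≰1 (≤-trans (s≤s (x∈p⇒∣p-x∣<∣p∣ y∈C-x)) ∣C-x∣<1))
      where
      C = component x
      y∈C-x : y ∈ₛ C - x
      y∈C-x = x∈p∧x≢y⇒x∈p-y (∈-component⁺ (reach-target∈X x∈X (proj₁ x⇄y) , x⇄y)) (x≢y ∘ sym)
      ∣C-x∣<1 : suc ∣ C - x ∣ ≤ 1
      ∣C-x∣<1 = ≤-trans (x∈p⇒∣p-x∣<∣p∣ (∈-component⁺ (x∈X , ⇄-refl)))
                        (≤-reflexive (singletons C (component-IsComponent x∈X)))
      2≰1 : ∀ {k} → ¬ suc (suc k) ≤ 1
      2≰1 (s≤s ())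

    ∈X⇒IsRep : ∀ {x} → x ∈ₛ X → IsRep x
    ∈X⇒IsRep x∈X = x∈X , λ y y<x x⇄y → Fin.<⇒≢ y<x (sym (⇄⇒≡ x∈X x⇄y))

    length-reps≡∣X∣ : length reps ≡ ∣ X ∣
    length-reps≡∣X∣ = ≤-antisym length-reps≤∣X∣ (≤-trans (≤-reflexive (sym (length-filter-∈?-allFin X)))
      (length-mono (Unique.filter⁺ (_∈? X) (Unique.allFin⁺ m))
        (∈-reps⁺ ∘ ∈X⇒IsRep ∘ proj₂ ∘ ∈-filter⁻ (_∈? X) {xs = allFin m})))

    length-nonAdjacentReps≡ : length nonAdjacentReps ≡ length nonAdjacentVertices
    length-nonAdjacentReps≡ = ≤-antisym length-nonAdjacentReps≤ (length-mono nonAdjacentVertices-unique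
      λ {(x , y)} xy∈ →
        let x<y , x∈X , y∈X , x↛y , y↛x = proj₂ (∈-filter⁻ NonAdjacentVertices? {xs = allPairs} xy∈) in
        ∈-nonAdjacentReps⁺ (∈X⇒IsRep x∈X , ∈X⇒IsRep y∈X , x<y ,
          λ p q x⇄p y⇄q → subst₂ (λ p q → ¬ E p q × ¬ E q p) (⇄⇒≡ x∈X x⇄p) (⇄⇒≡ y∈X y⇄q) (x↛y , y↛x)))

-- The digraph D_B(X)

EdgeAt : (Vec Bool 3 → Bool) → Rel (Fin 3) 0ℓ
EdgeAt M i j = i ≢ j × (∀ (u : Vec Bool 3) → lookup u i ≡ false → lookup u j ≡ true → M u ≡ true)

lookup-e : ∀ k i → lookup (e k) i ≡ does (k ≟ i)
lookup-e k i = trans (lookup∘tabulate (λ j → ⌊ k ≟ j ⌋) i) (isYes≗does (k ≟ i))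

lookup-ē : ∀ k i → lookup (ē k) i ≡ not (does (k ≟ i))
lookup-ē k i = trans (lookup-map i not (e k)) (cong not (lookup-e k i))

-- the third entry decides between the only two candidates
two-completions : ∀ {i j} (u : Vec Bool 3) → i ≢ j → lookup u i ≡ false → lookup u j ≡ true →
                  u ≡ e j ⊎ u ≡ ē i
two-completions {zero} {zero} _ i≢j _ _ = ⊥-elim (i≢j refl)
two-completions {suc zero} {suc zero} _ i≢j _ _ = ⊥-elim (i≢j refl)
two-completions {suc (suc zero)} {suc (suc zero)} _ i≢j _ _ = ⊥-elim (i≢j refl)
two-completions {zero} {suc zero} (_ ∷ _ ∷ false ∷ []) _ refl refl = inj₁ refl
two-completions {zero} {suc zero} (_ ∷ _ ∷ true ∷ []) _ refl refl = inj₂ refl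
two-completions {zero} {suc (suc zero)} (_ ∷ false ∷ _ ∷ []) _ refl refl = inj₁ refl
two-completions {zero} {suc (suc zero)} (_ ∷ true ∷ _ ∷ []) _ refl refl = inj₂ refl
two-completions {suc zero} {zero} (_ ∷ _ ∷ false ∷ []) _ refl refl = inj₁ refl
two-completions {suc zero} {zero} (_ ∷ _ ∷ true ∷ []) _ refl refl = inj₂ refl
two-completions {suc zero} {suc (suc zero)} (false ∷ _ ∷ _ ∷ []) _ refl refl = inj₁ refl
two-completions {suc zero} {suc (suc zero)} (true ∷ _ ∷ _ ∷ []) _ refl refl = inj₂ refl
two-completions {suc (suc zero)} {zero} (_ ∷ false ∷ _ ∷ []) _ refl refl = inj₁ refl
two-completions {suc (suc zero)} {zero} (_ ∷ true ∷ _ ∷ []) _ refl refl = inj₂ refl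
two-completions {suc (suc zero)} {suc zero} (false ∷ _ ∷ _ ∷ []) _ refl refl = inj₁ refl
two-completions {suc (suc zero)} {suc zero} (true ∷ _ ∷ _ ∷ []) _ refl refl = inj₂ refl

EdgeAt-intro : ∀ {M i j} → i ≢ j → M (e j) ≡ true → M (ē i) ≡ true → EdgeAt M i j
EdgeAt-intro {M} i≢j eⱼ∈ ēᵢ∈ = i≢j , λ u uᵢ uⱼ →
  [ (λ u≡eⱼ → subst (λ v → M v ≡ true) (sym u≡eⱼ) eⱼ∈)
  , (λ u≡ēᵢ → subst (λ v → M v ≡ true) (sym u≡ēᵢ) ēᵢ∈) ]
    (two-completions u i≢j uᵢ uⱼ)

module SortedTriple {m : ℕ} (B : Choice m) (good : Good B) {a b c : Fin m} (a<b : a < b) (b<c : b < c) where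

  M : Vec Bool 3 → Bool
  M = mem B a b c

  ē-mem : ∀ i → M (ē i) ≡ not (M (e i))
  ē-mem i with one-of-each B a b c a<b b<c i
  ... | inj₁ (eᵢ∈ , ēᵢ∉) = trans ēᵢ∉ (cong not (sym eᵢ∈))
  ... | inj₂ (eᵢ∉ , ēᵢ∈) = trans ēᵢ∈ (cong not (sym eᵢ∉))

  not-all-e : ¬ (∀ i → M (e i) ≡ true)
  not-all-e all-e = proj₁ (good a b c a<b b<c) λ v → members-are-e v , λ { (i , refl) → all-e i }
    where
    members-are-e : ∀ v → M v ≡ true → ∃ λ i → v ≡ e i
    members-are-e v v∈ with nothing-else B a b c a<b b<c v v∈
    ... | i , inj₁ v≡eᵢ = i , v≡eᵢ
    ... | i , inj₂ refl with () ← trans (sym v∈) (trans (ē-mem i) (cong not (all-e i)))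

  not-all-ē : ¬ (∀ i → M (e i) ≡ false)
  not-all-ē no-e = proj₂ (good a b c a<b b<c) λ v → members-are-ē v ,
    λ { (i , refl) → trans (ē-mem i) (cong not (no-e i)) }
    where
    members-are-ē : ∀ v → M v ≡ true → ∃ λ i → v ≡ ē i
    members-are-ē v v∈ with nothing-else B a b c a<b b<c v v∈
    ... | i , inj₂ v≡ēᵢ = i , v≡ēᵢ
    ... | i , inj₁ refl with () ← trans (sym v∈) (no-e i)

  EdgeAt-bySign : ∀ {i j} → i ≢ j → M (e i) ≡ false → M (e j) ≡ true → EdgeAt M i j
  EdgeAt-bySign {i} i≢j eᵢ∉ eⱼ∈ = EdgeAt-intro i≢j eⱼ∈ (trans (ē-mem i) (cong not eᵢ∉))

  -- the positions with e_x ∈ B_T receive edges from all the others, and goodness makes both kinds occur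
  apexAt : HasApex (EdgeAt M) zero (suc zero) (suc (suc zero))
  apexAt with M (e zero) in s₀ | M (e (suc zero)) in s₁ | M (e (suc (suc zero))) in s₂
  ... | true  | true  | true  = ⊥-elim (not-all-e λ { zero → s₀ ; (suc zero) → s₁ ; (suc (suc zero)) → s₂ })
  ... | false | false | false = ⊥-elim (not-all-ē λ { zero → s₀ ; (suc zero) → s₁ ; (suc (suc zero)) → s₂ })
  ... | false | false | true  = inj₂ (inj₂ (inj₂ (EdgeAt-bySign (λ ()) s₀ s₂ , EdgeAt-bySign (λ ()) s₁ s₂)))
  ... | false | true  | false = inj₂ (inj₁ (inj₂ (EdgeAt-bySign (λ ()) s₀ s₁ , EdgeAt-bySign (λ ()) s₂ s₁)))
  ... | true  | false | false = inj₁ (inj₂ (EdgeAt-bySign (λ ()) s₁ s₀ , EdgeAt-bySign (λ ()) s₂ s₀))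
  ... | true  | true  | false = inj₂ (inj₂ (inj₁ (EdgeAt-bySign (λ ()) s₂ s₀ , EdgeAt-bySign (λ ()) s₂ s₁)))
  ... | true  | false | true  = inj₂ (inj₁ (inj₁ (EdgeAt-bySign (λ ()) s₁ s₀ , EdgeAt-bySign (λ ()) s₁ s₂)))
  ... | false | true  | true  = inj₁ (inj₁ (EdgeAt-bySign (λ ()) s₀ s₁ , EdgeAt-bySign (λ ()) s₀ s₂))

  member⇒EdgeAt : ∀ w → M w ≡ true → ∃₂ λ i j → EdgeAt M i j × lookup w i ≡ false × lookup w j ≡ true
  member⇒EdgeAt w w∈ with nothing-else B a b c a<b b<c w w∈
  ... | k , inj₁ refl with Fin.¬∀⟶∃¬ 3 _ (λ i → M (e i) Bool.≟ true) not-all-e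
  ...   | i , eᵢ∉ = i , k , EdgeAt-bySign i≢k (Bool.¬-not eᵢ∉) w∈ ,
                    trans (lookup-e k i) (dec-false (k ≟ i) (i≢k ∘ sym)) ,
                    trans (lookup-e k k) (dec-true (k ≟ k) refl)
    where
    i≢k : i ≢ k
    i≢k refl = eᵢ∉ w∈
  member⇒EdgeAt w w∈ | k , inj₂ refl with Fin.¬∀⟶∃¬ 3 _ (λ i → M (e i) Bool.≟ false) not-all-ē
  ...   | j , eⱼ∈ = k , j , EdgeAt-bySign k≢j eₖ∉ (Bool.¬-not eⱼ∈) ,
                    trans (lookup-ē k k) (cong not (dec-true (k ≟ k) refl)) ,
                    trans (lookup-ē k j) (cong not (dec-false (k ≟ j) k≢j))
    where
    eₖ∉ : M (e k) ≡ false
    eₖ∉ with M (e k) in eₖ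
    ... | false = refl
    ... | true with () ← trans (sym w∈) (trans (ē-mem k) (cong not eₖ))
    k≢j : k ≢ j
    k≢j refl = eⱼ∈ eₖ∉

allᶠ-true⁻ : ∀ {m} (p : Fin m → Bool) → allᶠ p ≡ true → ∀ i → p i ≡ true
allᶠ-true⁻ {m} p all-p i = go (allFin m) all-p (∈-allFin i)
  where
  go : ∀ is → foldr (λ j r → p j ∧ r) true is ≡ true → i ∈ₗ is → p i ≡ true
  go (j ∷ is) h i∈ with p j in pⱼ | i∈
  ... | true | here refl = pⱼ
  ... | true | there i∈is = go is h i∈is
  ... | false | _ with () ← h

allᶠ-true⁺ : ∀ {m} (p : Fin m → Bool) → (∀ i → p i ≡ true) → allᶠ p ≡ true
allᶠ-true⁺ {m} p all-p = go (allFin m)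
  where
  go : ∀ is → foldr (λ j r → p j ∧ r) true is ≡ true
  go [] = refl
  go (j ∷ is) rewrite all-p j = go is

allVecs-unique : ∀ m → Unique (allVecs m)
allVecs-unique zero = [] ∷ []
allVecs-unique (suc m) = Unique.++⁺ (Unique.map⁺ ∷-injectiveʳ (allVecs-unique m))
                                    (Unique.map⁺ ∷-injectiveʳ (allVecs-unique m)) disjoint
  where
  disjoint : ∀ {v} → ¬ (v ∈ₗ map (false ∷_) (allVecs m) × v ∈ₗ map (true ∷_) (allVecs m))
  disjoint (v∈₀ , v∈₁) with ∈-map⁻ (false ∷_) v∈₀ | ∈-map⁻ (true ∷_) v∈₁
  ... | _ , _ , refl | _ , _ , ()

∈-allVecs : ∀ {m} (u : Vec Bool m) → u ∈ₗ allVecs m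
∈-allVecs [] = here refl
∈-allVecs (false ∷ u) = ∈-++⁺ˡ (∈-map⁺ (false ∷_) (∈-allVecs u))
∈-allVecs {suc m} (true ∷ u) = ∈-++⁺ʳ (map (false ∷_) (allVecs m)) (∈-map⁺ (true ∷_) (∈-allVecs u))

module ChoiceDigraph {m : ℕ} (B : Choice m) (good : Good B) (X : Subset m) where

  position∈X : ∀ {a b c} → a ∈ₛ X → b ∈ₛ X → c ∈ₛ X → ∀ i → lookup (triple a b c) i ∈ₛ X
  position∈X a∈X _ _ zero = a∈X
  position∈X _ b∈X _ (suc zero) = b∈X
  position∈X _ _ c∈X (suc (suc zero)) = c∈X

  Edge⊆X : ∀ {x y} → Edge B X x y → x ∈ₛ X × y ∈ₛ X
  Edge⊆X (_ , _ , _ , _ , _ , a∈X , b∈X , c∈X , i , j , _ , refl , refl , _) =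
    position∈X a∈X b∈X c∈X i , position∈X a∈X b∈X c∈X j

  EdgeAt⇒Edge : ∀ {a b c i j} → a < b → b < c → a ∈ₛ X → b ∈ₛ X → c ∈ₛ X →
    EdgeAt (mem B a b c) i j → Edge B X (lookup (triple a b c) i) (lookup (triple a b c) j)
  EdgeAt⇒Edge a<b b<c a∈X b∈X c∈X (i≢j , fill) =
    _ , _ , _ , a<b , b<c , a∈X , b∈X , c∈X , _ , _ , i≢j , refl , refl , fill

  Edge? : Decidable (Edge B X)
  Edge? x y = Fin.any? λ a → Fin.any? λ b → Fin.any? λ c →
    (a <? b) ×-dec ((b <? c) ×-dec ((a ∈? X) ×-dec ((b ∈? X) ×-dec ((c ∈? X) ×-dec
    (Fin.any? λ i → Fin.any? λ j → ¬? (i ≟ j) ×-dec ((lookup (triple a b c) i ≟ x) ×-dec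
      ((lookup (triple a b c) j ≟ y) ×-dec allSubset? λ u →
        (lookup u i Bool.≟ false) →-dec ((lookup u j Bool.≟ true) →-dec (mem B a b c u Bool.≟ true)))))))))

  Edge-apex : ∀ {x y z} → x ∈ₛ X → y ∈ₛ X → z ∈ₛ X → x ≢ y → y ≢ z → x ≢ z → HasApex (Edge B X) x y z
  Edge-apex x∈X y∈X z∈X x≢y y≢z x≢z = sorted⇒distinct ApexIfInX
    (λ apex y∈X x∈X z∈X → HasApex-swap₁₂ (Edge B X) (apex x∈X y∈X z∈X))
    (λ apex x∈X z∈X y∈X → HasApex-swap₂₃ (Edge B X) (apex x∈X y∈X z∈X))
    (λ {a} {b} {c} a<b b<c a∈X b∈X c∈X → HasApex-map {S = Edge B X} (lookup (triple a b c))
        (λ {i} {j} → EdgeAt⇒Edge {i = i} {j} a<b b<c a∈X b∈X c∈X) (SortedTriple.apexAt B good a<b b<c))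
    x≢y y≢z x≢z x∈X y∈X z∈X
    where
    ApexIfInX : Fin m → Fin m → Fin m → Set
    ApexIfInX x y z = x ∈ₛ X → y ∈ₛ X → z ∈ₛ X → HasApex (Edge B X) x y z

  open ApexDigraph X (Edge B X) Edge? Edge⊆X Edge-apex public

  supportedIn⇒⊆ : ∀ u → supportedIn X u ≡ true → u ⊆ X
  supportedIn⇒⊆ u supported {i} i∈u = lookup⇒[]= i X
    (subst (λ uᵢ → not uᵢ ∨ lookup X i ≡ true) ([]=⇒lookup i∈u) (allᶠ-true⁻ _ supported i))

  ⊆⇒supportedIn : ∀ u → u ⊆ X → supportedIn X u ≡ true
  ⊆⇒supportedIn u u⊆X = allᶠ-true⁺ _ entry
    where
    entry : ∀ i → not (lookup u i) ∨ lookup X i ≡ true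
    entry i with lookup u i in uᵢ
    ... | false = refl
    ... | true = []=⇒lookup (u⊆X (lookup⇒[]= i u uᵢ))

  restrict : Vec Bool m → Fin m → Fin m → Fin m → Vec Bool 3
  restrict u a b c = lookup u a ∷ lookup u b ∷ lookup u c ∷ []

  lookup-restrict : ∀ u a b c i → lookup (restrict u a b c) i ≡ lookup u (lookup (triple a b c) i)
  lookup-restrict u a b c i = lookup-map i (lookup u) (triple a b c)

  violated-entry : ∀ {u a b c} → a < b → b < c → a ∈ₛ X → b ∈ₛ X → c ∈ₛ X →
    mem B a b c (restrict u a b c) ≡ true →
    not (⌊ a <? b ⌋ ∧ ⌊ b <? c ⌋ ∧ lookup X a ∧ lookup X b ∧ lookup X c) ∨ not (mem B a b c (restrict u a b c)) ≡ false
  violated-entry {a = a} {b} {c} a<b b<c a∈X b∈X c∈X restriction∈B with a <? b | b <? c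
  ... | no a≮b | _ = ⊥-elim (a≮b a<b)
  ... | yes _ | no b≮c = ⊥-elim (b≮c b<c)
  ... | yes _ | yes _ rewrite []=⇒lookup a∈X | []=⇒lookup b∈X | []=⇒lookup c∈X | restriction∈B = refl

  avoids⇒Closed : ∀ u → avoids B X u ≡ true → Closed u
  avoids⇒Closed u avoiding (a , b , c , a<b , b<c , a∈X , b∈X , c∈X , i , j , _ , refl , refl , fill) y∈u =
    decidable-stable (_ ∈? u) λ x∉u →
      let restriction∈B = fill (restrict u a b c)
            (trans (lookup-restrict u a b c i) (Bool.¬-not (x∉u ∘ lookup⇒[]= _ u)))
            (trans (lookup-restrict u a b c j) ([]=⇒lookup y∈u))
      in Bool.not-¬ (violated-entry {u} a<b b<c a∈X b∈X c∈X restriction∈B)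
           (allᶠ-true⁻ _ (allᶠ-true⁻ _ (allᶠ-true⁻ _ avoiding a) b) c)

  Closed⇒avoids : ∀ u → Closed u → avoids B X u ≡ true
  Closed⇒avoids u closed = allᶠ-true⁺ _ λ a → allᶠ-true⁺ _ λ b → allᶠ-true⁺ _ λ c → entry a b c
    where
    entry : ∀ a b c → not (⌊ a <? b ⌋ ∧ ⌊ b <? c ⌋ ∧ lookup X a ∧ lookup X b ∧ lookup X c) ∨
                      not (mem B a b c (restrict u a b c)) ≡ true
    entry a b c with a <? b | b <? c | lookup X a in aX | lookup X b in bX | lookup X c in cX
    ... | no _ | _ | _ | _ | _ = refl
    ... | yes _ | no _ | _ | _ | _ = refl
    ... | yes _ | yes _ | false | _ | _ = refl
    ... | yes _ | yes _ | true | false | _ = refl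
    ... | yes _ | yes _ | true | true | false = refl
    ... | yes a<b | yes b<c | true | true | true with mem B a b c (restrict u a b c) in restriction∈B
    ...   | false = refl
    ...   | true with SortedTriple.member⇒EdgeAt B good a<b b<c _ restriction∈B
    ...     | i , j , edge , wᵢ , wⱼ with () ← trans (sym wᵢ) (trans (lookup-restrict u a b c i)
              ([]=⇒lookup (closed (EdgeAt⇒Edge a<b b<c (lookup⇒[]= a X aX) (lookup⇒[]= b X bX) (lookup⇒[]= c X cX) edge)
                                  (lookup⇒[]= _ u (trans (sym (lookup-restrict u a b c j)) wⱼ)))))

  closedSets : List (Vec Bool m)
  closedSets = filterᵇ (λ u → supportedIn X u ∧ avoids B X u) (allVecs m)

  cnt≡ : cnt B X ≡ suc (length reps + length nonAdjacentReps)
  cnt≡ = length-closedSets closedSets (Unique.filter⁺ (T? ∘ admissible) (allVecs-unique m)) sound complete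
    where
    admissible : Vec Bool m → Bool
    admissible u = supportedIn X u ∧ avoids B X u
    sound : ∀ {u} → u ∈ₗ closedSets → u ⊆ X × Closed u
    sound {u} u∈ =
      let supp , avoid = Equivalence.to Bool.T-∧ (proj₂ (∈-filter⁻ (T? ∘ admissible) {xs = allVecs m} u∈)) in
      supportedIn⇒⊆ u (Equivalence.to Bool.T-≡ supp) , avoids⇒Closed u (Equivalence.to Bool.T-≡ avoid)
    complete : ∀ {u} → u ⊆ X → Closed u → u ∈ₗ closedSets
    complete {u} u⊆X u-closed = ∈-filter⁺ (T? ∘ admissible) (∈-allVecs u)
      (Equivalence.from Bool.T-∧ (Equivalence.from Bool.T-≡ (⊆⇒supportedIn u u⊆X) ,
                                  Equivalence.from Bool.T-≡ (Closed⇒avoids u u-closed)))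

lemma3p1 : ∀ {m} (B : Choice m) → Good B → (X : Subset m) →
    (Σ ℕ λ t → Σ ℕ λ nt → NumSCC B X t × NumNonAdjSCCPairs B X nt ×
       cnt B X ≡ nt + t + 1)
    × (Σ ℕ λ n → NumNonAdjPairs B X n ×
       cnt B X ≤ n + ∣ X ∣ + 1 ×
       ((∀ S → IsSCC B X S → ∣ S ∣ ≡ 1) → cnt B X ≡ n + ∣ X ∣ + 1))
lemma3p1 B good X =
    (t , nt , numSCC , numNonAdjacentSCCs , cnt≡nt+t+1)
  , (n , numNonAdjacentVertices ,
     ≤-trans (≤-reflexive cnt≡nt+t+1) (+-monoˡ-≤ 1 (+-mono-≤ length-nonAdjacentReps≤ length-reps≤∣X∣)) ,
     λ singletons → let open SingletonComponents singletons in
       trans cnt≡nt+t+1 (cong₂ (λ a b → a + b + 1) length-nonAdjacentReps≡ length-reps≡∣X∣))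
  where
  open ChoiceDigraph B good X
  t = length reps
  nt = length nonAdjacentReps
  n = length nonAdjacentVertices
  cnt≡nt+t+1 : cnt B X ≡ nt + t + 1
  cnt≡nt+t+1 = trans cnt≡ (trans (cong suc (+-comm t nt)) (+-comm 1 (nt + t)))
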